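{- Let $d$ be a positive integer. For all $(x_1,x_2,\ldots,x_d)\in\mathbb{N}^d$, $$\max(x_1,x_2,\ldots,x_d)=\Bigl\lfloor\sqrt[d]{r_d(x_1,x_2,\ldots,x_d)}\Bigr\rfloor.$$
   Context: $\mathbb{N}$ denotes the set of non-negative integers. The Rosenberg-Strong $d$-tupling function $r_d\colon\mathbb{N}^d\to\mathbb{N}$ is defined recursively by $r_1(x_1)=x_1$ and, for integers $d>1$, $r_d(x_1,\ldots,x_{d-1},x_d)=r_{d-1}(x_1,\ldots,x_{d-1})+m^d+(m-x_d)\bigl((m+1)^{d-1}-m^{d-1}\bigr)$, where $m=\max(x_1,\ldots,x_d)$. -}

module Defs where

open import Data.Nat using (ℕ; zero; suc; _+_; _*_; _∸_; _^_; _⊔_; _≤_; _<_)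
open import Data.Fin using (Fin; inject₁; fromℕ)
open import Data.Product using (_×_)

-- A point of ℕ^d with d = suc n, as a function Fin (suc n) → ℕ.
-- Coordinate x_i (1-based in the paper) is x (i-1); x_d is x (fromℕ n).

maxℕ : (n : ℕ) → (Fin (suc n) → ℕ) → ℕ
maxℕ zero    x = x (fromℕ zero)
maxℕ (suc n) x = maxℕ n (λ i → x (inject₁ i)) ⊔ x (fromℕ (suc n))

-- Rosenberg–Strong tupling r_d with d = suc n:
-- r_1(x_1) = x_1,
-- r_d(x) = r_{d-1}(x_1..x_{d-1}) + m^d + (m - x_d)((m+1)^{d-1} - m^{d-1}),  m = max x.
-- (m - x_d ≥ 0 and (m+1)^{d-1} ≥ m^{d-1}, so truncated subtraction is exact.)
rs : (n : ℕ) → (Fin (suc n) → ℕ) → ℕ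
rs zero    x = x (fromℕ zero)
rs (suc n) x =
  rs n (λ i → x (inject₁ i))
  + m ^ (suc (suc n))
  + (m ∸ x (fromℕ (suc n))) * ((suc m) ^ (suc n) ∸ m ^ (suc n))
  where
  m = maxℕ (suc n) x

IsFloorRoot : (d N m : ℕ) → Set
IsFloorRoot d N m = (m ^ d ≤ N) × (N < (suc m) ^ d)

module Submission where

-- The lower bound is immediate: the summand m^d occurs in the defining recursion. Write A = (m+1)^{d-1}, B = m^{d-1} and
-- c = m - x_d. The maximum m' of the first d-1 coordinates is at most m, so the
-- induction hypothesis gives r_{d-1} < (m'+1)^{d-1} ≤ A. The purely arithmetic
-- lemma  r < A, c ≤ m, B ≤ A  ⟹  r + m·B + c·(A - B) < A + m·A  then finishes,
-- because m^d = m·B and (m+1)^d = (m+1)·A = A + m·A.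

open import Defs
open import Data.Nat using (ℕ; zero; suc; _+_; _*_; _∸_; _^_; _≤_; _<_; s≤s)
open import Data.Nat.Properties
open import Data.Fin using (Fin; inject₁; fromℕ)
open import Data.Product using (_,_)
open import Relation.Binary.PropositionalEquality using (cong; sym)

sum-below-next-power : ∀ r m c A B → r < A → c ≤ m → B ≤ A →
                       r + m * B + c * (A ∸ B) < A + m * A
sum-below-next-power r m c A B r<A c≤m B≤A = begin-strict
  r + m * B + c * (A ∸ B)   <⟨ +-mono-<-≤ (+-monoˡ-< (m * B) r<A) (*-monoˡ-≤ (A ∸ B) c≤m) ⟩
  A + m * B + m * (A ∸ B)   ≡⟨ +-assoc A (m * B) (m * (A ∸ B)) ⟩
  A + (m * B + m * (A ∸ B)) ≡⟨ cong (A +_) (sym (*-distribˡ-+ m B (A ∸ B))) ⟩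
  A + m * (B + (A ∸ B))     ≡⟨ cong (λ t → A + m * t) (m+[n∸m]≡n B≤A) ⟩
  A + m * A                 ∎
  where open ≤-Reasoning

maxℕ-init≤maxℕ : ∀ n (x : Fin (suc (suc n)) → ℕ) →
                 maxℕ n (λ i → x (inject₁ i)) ≤ maxℕ (suc n) x
maxℕ-init≤maxℕ n x = m≤m⊔n _ _

rs-lower : ∀ n (x : Fin (suc n) → ℕ) → maxℕ n x ^ suc n ≤ rs n x
rs-lower zero    x = ≤-reflexive (^-identityʳ (x (fromℕ zero)))
rs-lower (suc n) x = ≤-trans (m≤n+m _ (rs n _)) (m≤m+n _ _)

rs-upper : ∀ n (x : Fin (suc n) → ℕ) → rs n x < suc (maxℕ n x) ^ suc n
rs-upper zero    x = ≤-reflexive (cong suc (sym (^-identityʳ (x (fromℕ zero)))))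
rs-upper (suc n) x =
  sum-below-next-power (rs n init) m (m ∸ last)
    (suc m ^ suc n) (m ^ suc n)
    rs-init<A (m∸n≤m m last) (^-monoˡ-≤ (suc n) (n≤1+n m))
  where
  init : Fin (suc n) → ℕ
  init i = x (inject₁ i)

  last : ℕ
  last = x (fromℕ (suc n))

  m : ℕ
  m = maxℕ (suc n) x

  rs-init<A : rs n init < suc m ^ suc n
  rs-init<A = ≤-trans (rs-upper n init)
                      (^-monoˡ-≤ (suc n) (s≤s (maxℕ-init≤maxℕ n x)))

corollary13 : (n : ℕ) (x : Fin (suc n) → ℕ) →
    IsFloorRoot (suc n) (rs n x) (maxℕ n x)
corollary13 n x = rs-lower n x , rs-upper n x
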